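{- Let $\mu,\nu,\lambda$ be partitions and suppose $\lambda=w\big((\mu,\nu)+\delta\big)-\delta$ for some permutation $w$. Let $\gamma$ be a partition with $\gamma\neq\mu$, where $\mu$ and $\gamma$ are both regarded as vectors of the same length $n$ (possibly containing zeros). Then $\lambda\neq\sigma\big((\gamma,\nu)+\delta\big)-\delta$ for every permutation $\sigma$.
   Context: $(\mu,\nu)$ denotes concatenation of vectors; if $(\mu,\nu)$ has length $N$ then $\delta=(N-1,N-2,\dots,1,0)$, and a permutation $w$ of $\{1,\dots,N\}$ acts on vectors of length $N$ by permuting entries. -}

module Defs where

open import Data.Nat using (ℕ; _≤_; _∸_)
open import Data.Fin using (Fin; toℕ) renaming (_≤_ to _≤ᶠ_)
open import Data.Integer using (ℤ; +_; _+_; _-_)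
open import Data.Vec using (Vec; lookup)
open import Data.Fin.Permutation using (Permutation′; _⟨$⟩ˡ_)

IsPartition : ∀ {k} → Vec ℕ k → Set
IsPartition {k} v = (i j : Fin k) → i ≤ᶠ j → lookup v j ≤ lookup v i

δ : (N : ℕ) → Fin N → ℤ
δ N i = + (N ∸ 1 ∸ toℕ i)

toℤ : ∀ {N} → Vec ℕ N → Fin N → ℤ
toℤ v i = + lookup v i

-- permutation action on vectors: (w v)_{w(i)} = v_i, i.e. (w v)_j = v_{w⁻¹ j}
act : ∀ {N} → Permutation′ N → (Fin N → ℤ) → (Fin N → ℤ)
act w v j = v (w ⟨$⟩ˡ j)

dot : ∀ {N} → Permutation′ N → (Fin N → ℤ) → (Fin N → ℤ)
dot {N} w v j = act w (λ i → v i + δ N i) j - δ N j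

{-# OPTIONS --safe #-}
module Submission where

-- Since λ is a partition, λ + δ is strictly decreasing, so both (μ,ν) + δ and
-- (γ,ν) + δ are injective rearrangements of it and take the same values. If k is
-- the first index with μ_k ≠ γ_k, say γ_k < μ_k, then μ_k + δ_k is taken by
-- (γ,ν) + δ at some index p. At an index where (μ,ν) and (γ,ν) agree, injectivity
-- forces p = k; otherwise p is a later position in the γ block, where
-- γ_p + δ_p < γ_k + δ_k < μ_k + δ_k.

open import Defs
open import Data.Nat using (ℕ; _+_)
open import Data.Vec using (Vec; _++_)
open import Data.Product using (∃)
open import Data.Fin.Permutation using (Permutation′)
open import Relation.Nullary using (¬_)
open import Relation.Binary.PropositionalEquality using (_≢_; _≗_)

open import Level using (0ℓ)
open import Algebra.Properties.Group using (//-rightDividesˡ)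
open import Data.Nat using (_≤_; _<_; _∸_)
open import Data.Nat.Properties
  using (≤-antisym; ≤-reflexive; <⇒≤; <⇒≢; ≮⇒≥; +-mono-≤; +-mono-≤-<; +-cancelʳ-≤; ∸-monoʳ-≤; ∸-monoʳ-<; module ≤-Reasoning)
open import Data.Fin as Fin using (Fin; toℕ; _↑ˡ_; splitAt; join)
open import Data.Fin.Properties using (<-cmp; _<?_; toℕ-↑ˡ; toℕ≤pred[n]; join-splitAt)
open import Data.Fin.Induction using (<-wellFounded)
open import Data.Fin.Permutation using (_⟨$⟩ʳ_; _⟨$⟩ˡ_; inverseˡ; inverseʳ)
open import Data.Integer as ℤ using (+_)
open import Data.Integer.Properties using (+-injective; +-0-abelianGroup)
open import Algebra.Bundles using (AbelianGroup)
open import Data.Vec using (lookup)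
open import Data.Vec.Properties using (lookup-++ˡ; lookup-++ʳ; tabulate∘lookup; tabulate-cong)
open import Data.Product using (_,_)
open import Data.Sum using (_⊎_; inj₁; inj₂)
open import Function using (_∘_)
open import Function.Bundles using (Injection)
open import Function.Definitions using (Injective)
open import Function.Properties.Inverse using (Inverse⇒Injection)
open import Induction.WellFounded using (module All)
open import Relation.Nullary using (yes; no; contradiction)
open import Relation.Binary.Definitions using (tri<; tri≈; tri>)
open import Relation.Binary.PropositionalEquality
  using (_≡_; sym; trans; cong; subst; subst₂; module ≡-Reasoning)

lookup-extensional : ∀ {A : Set} {n} {u v : Vec A n} → lookup u ≗ lookup v → u ≡ v
lookup-extensional {u = u} {v} u≗v =
  trans (sym (tabulate∘lookup u)) (trans (tabulate-cong u≗v) (tabulate∘lookup v))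

-- The entries of v + δ; toℤ v i ℤ.+ δ N i reduces to + (v +δ) i.
_+δ : ∀ {N} → Vec ℕ N → Fin N → ℕ
_+δ {N} v i = lookup v i + (N ∸ 1 ∸ toℕ i)

dot⇒+δ : ∀ {N} (lam v : Vec ℕ N) (w : Permutation′ N) →
         toℤ lam ≗ dot w (toℤ v) → v +δ ≗ lam +δ ∘ (w ⟨$⟩ʳ_)
dot⇒+δ {N} lam v w lam≗ i = +-injective (begin
  + (v +δ) i                 ≡⟨ cong (+_ ∘ v +δ) (inverseˡ w) ⟨
  + (v +δ) (w ⟨$⟩ˡ j)        ≡⟨ //-rightDividesˡ (AbelianGroup.group +-0-abelianGroup) (δ N j) _ ⟨
  dot w (toℤ v) j ℤ.+ δ N j  ≡⟨ cong (ℤ._+ δ N j) (lam≗ j) ⟨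
  + (lam +δ) j               ∎)
  where
  open ≡-Reasoning
  j : Fin N
  j = w ⟨$⟩ʳ i

+δ-antitone : ∀ {N} (v : Vec ℕ N) {i j : Fin N} →
              i Fin.≤ j → lookup v j ≤ lookup v i → (v +δ) j ≤ (v +δ) i
+δ-antitone {N} v i≤j vj≤vi = +-mono-≤ vj≤vi (∸-monoʳ-≤ (N ∸ 1) i≤j)

+δ-strictlyAntitone : ∀ {N} (v : Vec ℕ N) {i j : Fin N} →
                      i Fin.< j → lookup v j ≤ lookup v i → (v +δ) j < (v +δ) i
+δ-strictlyAntitone v {j = j} i<j vj≤vi =
  +-mono-≤-< vj≤vi (∸-monoʳ-< i<j (toℕ≤pred[n] j))

+δ-injective : ∀ {N} (v : Vec ℕ N) → IsPartition v → Injective _≡_ _≡_ (v +δ)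
+δ-injective v v-partition {i} {j} eq with <-cmp i j
... | tri< i<j _ _ = contradiction (sym eq) (<⇒≢ (+δ-strictlyAntitone v i<j (v-partition i j (<⇒≤ i<j))))
... | tri≈ _ i≡j _ = i≡j
... | tri> _ _ j<i = contradiction eq (<⇒≢ (+δ-strictlyAntitone v j<i (v-partition j i (<⇒≤ j<i))))

module _ {N} {A : Set} (f : Fin N → A) where

  rearrangement-injective : Injective _≡_ _≡_ f → (w : Permutation′ N) {a : Fin N → A} →
                            a ≗ f ∘ (w ⟨$⟩ʳ_) → Injective _≡_ _≡_ a
  rearrangement-injective f-injective w a≗ {x} {y} ax≡ay =
    Injection.injective (Inverse⇒Injection w) (f-injective (trans (sym (a≗ x)) (trans ax≡ay (a≗ y))))

  rearrangement-⊆ : (w σ : Permutation′ N) {a b : Fin N → A} →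
                    a ≗ f ∘ (w ⟨$⟩ʳ_) → b ≗ f ∘ (σ ⟨$⟩ʳ_) → ∀ i → ∃ λ p → a i ≡ b p
  rearrangement-⊆ w σ {a} {b} a≗ b≗ i = p , (begin
    a i               ≡⟨ a≗ i ⟩
    f (w ⟨$⟩ʳ i)      ≡⟨ cong f (inverseʳ σ) ⟨
    f (σ ⟨$⟩ʳ p)      ≡⟨ b≗ p ⟨
    b p               ∎)
    where
    open ≡-Reasoning
    p : Fin N
    p = σ ⟨$⟩ˡ (w ⟨$⟩ʳ i)

module _ {I : Set} (a b : I → ℕ) where

  DisagreementBound : I → Set
  DisagreementBound k = ∀ p → a p ≡ b p ⊎ b p ≤ b k

  disagreementBound⇒≤ : Injective _≡_ _≡_ a → (∀ i → ∃ λ p → a i ≡ b p) →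
                        ∀ k → DisagreementBound k → a k ≤ b k
  disagreementBound⇒≤ a-injective a⊆b k bound with a⊆b k
  ... | p , ak≡bp with bound p
  ...   | inj₁ ap≡bp = ≤-reflexive (trans ak≡bp (cong b (a-injective (trans ap≡bp (sym ak≡bp)))))
  ...   | inj₂ bp≤bk = subst (_≤ b k) (sym ak≡bp) bp≤bk

module _ {n m} (μ γ : Vec ℕ n) (ν : Vec ℕ m) where

  prefixAgreement⇒disagreementBound :
    IsPartition γ → (k : Fin n) → (∀ {q} → q Fin.< k → lookup μ q ≡ lookup γ q) →
    DisagreementBound ((μ ++ ν) +δ) ((γ ++ ν) +δ) (k ↑ˡ m)
  prefixAgreement⇒disagreementBound γ-partition k agree p =
    subst Bounded (join-splitAt n m p) (bounded (splitAt n p))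
    where
    Bounded : Fin (n + m) → Set
    Bounded p = ((μ ++ ν) +δ) p ≡ ((γ ++ ν) +δ) p ⊎ ((γ ++ ν) +δ) p ≤ ((γ ++ ν) +δ) (k ↑ˡ m)
    bounded : ∀ s → Bounded (join n m s)
    bounded (inj₂ j) = inj₁ (cong (_+ _) (trans (lookup-++ʳ μ ν j) (sym (lookup-++ʳ γ ν j))))
    bounded (inj₁ q) with q <? k
    ... | yes q<k = inj₁ (cong (_+ _) (trans (lookup-++ˡ μ ν q) (trans (agree q<k) (sym (lookup-++ˡ γ ν q)))))
    ... | no  q≮k = inj₂ (+δ-antitone (γ ++ ν)
      (subst₂ _≤_ (sym (toℕ-↑ˡ k m)) (sym (toℕ-↑ˡ q m)) k≤q)
      (subst₂ _≤_ (sym (lookup-++ˡ γ ν q)) (sym (lookup-++ˡ γ ν k)) (γ-partition k q k≤q)))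
      where
      k≤q : k Fin.≤ q
      k≤q = ≮⇒≥ q≮k

firstDifference-≤ : ∀ {n m} (μ γ : Vec ℕ n) (ν : Vec ℕ m) → IsPartition γ →
  Injective _≡_ _≡_ ((μ ++ ν) +δ) → (∀ i → ∃ λ p → ((μ ++ ν) +δ) i ≡ ((γ ++ ν) +δ) p) →
  (k : Fin n) → (∀ {q} → q Fin.< k → lookup μ q ≡ lookup γ q) → lookup μ k ≤ lookup γ k
firstDifference-≤ {n} {m} μ γ ν γ-partition μν-injective μν⊆γν k agree =
  +-cancelʳ-≤ d _ _ (begin
    lookup μ k + d          ≡⟨ cong (_+ d) (lookup-++ˡ μ ν k) ⟨
    ((μ ++ ν) +δ) (k ↑ˡ m)  ≤⟨ disagreementBound⇒≤ _ _ μν-injective μν⊆γν (k ↑ˡ m)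
                                 (prefixAgreement⇒disagreementBound μ γ ν γ-partition k agree) ⟩
    ((γ ++ ν) +δ) (k ↑ˡ m)  ≡⟨ cong (_+ d) (lookup-++ˡ γ ν k) ⟩
    lookup γ k + d          ∎)
  where
  open ≤-Reasoning
  d : ℕ
  d = n + m ∸ 1 ∸ toℕ (k ↑ˡ m)

lemma1 : (n m : ℕ) (μ γ : Vec ℕ n) (ν : Vec ℕ m) (lam : Vec ℕ (n + m)) →
    IsPartition μ → IsPartition ν → IsPartition lam → IsPartition γ →
    (∃ λ (w : Permutation′ (n + m)) → toℤ lam ≗ dot w (toℤ (μ ++ ν))) →
    γ ≢ μ →
    (σ : Permutation′ (n + m)) → ¬ (toℤ lam ≗ dot σ (toℤ (γ ++ ν)))
lemma1 n m μ γ ν lam μ-partition _ lam-partition γ-partition (w , lam≗w·μν) γ≢μ σ lam≗σ·γν =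
  γ≢μ (sym (lookup-extensional (All.wfRec <-wellFounded 0ℓ _ agreeAt)))
  where
  μν+δ≗ : (μ ++ ν) +δ ≗ lam +δ ∘ (w ⟨$⟩ʳ_)
  μν+δ≗ = dot⇒+δ lam (μ ++ ν) w lam≗w·μν
  γν+δ≗ : (γ ++ ν) +δ ≗ lam +δ ∘ (σ ⟨$⟩ʳ_)
  γν+δ≗ = dot⇒+δ lam (γ ++ ν) σ lam≗σ·γν
  lam+δ-injective : Injective _≡_ _≡_ (lam +δ)
  lam+δ-injective = +δ-injective lam lam-partition
  agreeAt : ∀ k → (∀ {q} → q Fin.< k → lookup μ q ≡ lookup γ q) → lookup μ k ≡ lookup γ k
  agreeAt k agree = ≤-antisym
    (firstDifference-≤ μ γ ν γ-partition
      (rearrangement-injective (lam +δ) lam+δ-injective w μν+δ≗)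
      (rearrangement-⊆ (lam +δ) w σ μν+δ≗ γν+δ≗) k agree)
    (firstDifference-≤ γ μ ν μ-partition
      (rearrangement-injective (lam +δ) lam+δ-injective σ γν+δ≗)
      (rearrangement-⊆ (lam +δ) σ w γν+δ≗ μν+δ≗) k (sym ∘ agree))
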